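{- The satisfaction system $\Lambda_{\mathcal{ALC}}$ of the description logic $\mathcal{ALC}$ is neither reception-compatible nor eviction-compatible.
   Context: Let $N_C,N_R,N_I$ be countably infinite, pairwise disjoint sets of concept, role and individual names. $\mathcal{ALC}$ concepts are given by $C::=A\mid\neg C\mid(C\sqcap C)\mid\exists r.C$ with $A\in N_C$, $r\in N_R$. The language $\mathcal{L}_{\mathcal{ALC}}$ consists of axioms $C(a)$, $r(a,b)$, $C\sqsubseteq D$ with $C,D$ concepts, $a,b\in N_I$, $r\in N_R$. Models are interpretations $I=(\Delta^I,\cdot^I)$ with $\Delta^I$ non-empty, $A^I\subseteq\Delta^I$, $r^I\subseteq\Delta^I\times\Delta^I$, $a^I\in\Delta^I$, extended by $(\neg C)^I=\Delta^I\setminus C^I$, $(C\sqcap D)^I=C^I\cap D^I$, $(\exists r.C)^I=\{d\mid\exists e:(d,e)\in r^I, e\in C^I\}$; $I\models C(a)$ iff $a^I\in C^I$, $I\models r(a,b)$ iff $(a^I,b^I)\in r^I$, $I\models C\sqsubseteq D$ iff $C^I\subseteq D^I$, and $I\models B$ iff $I$ satisfies every axiom of $B$. For a satisfaction system $\Lambda=(\mathcal{L},\mathfrak{M},\models)$: $\mathrm{Mod}(B)=\{m\in\mathfrak{M}\mid m\models B\}$; $\mathrm{FR}(\Lambda)=\{\mathrm{Mod}(B)\mid B\subseteq\mathcal{L}$ finite$\}$; $\mathrm{FRsubs}(\mathbb{M},\Lambda)$ is the set of $\subseteq$-maximal elements of $\{Y\in\mathrm{FR}(\Lambda)\mid Y\subseteq\mathbb{M}\}$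 and $\mathrm{FRsups}(\mathbb{M},\Lambda)$ the set of $\subseteq$-minimal elements of $\{Y\in\mathrm{FR}(\Lambda)\mid\mathbb{M}\subseteq Y\}$. $\Lambda$ is eviction-compatible if $\mathrm{FRsubs}(\mathrm{Mod}(B)\setminus\mathbb{M},\Lambda)\neq\emptyset$ for all finite $B\subseteq\mathcal{L}$ and sets of models $\mathbb{M}$; it is reception-compatible if $\mathrm{FRsups}(\mathrm{Mod}(B)\cup\mathbb{M},\Lambda)\neq\emptyset$ for all finite $B$ and $\mathbb{M}$. -}

module Defs where

open import Data.Nat using (ℕ)
open import Data.List using (List)
open import Data.List.Relation.Unary.All using (All)
open import Data.Product using (Σ; _×_; ∃)
open import Data.Sum using (_⊎_)
open import Relation.Nullary using (¬_)


-- Concept names, role names and individual names: three disjoint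
-- countably infinite sets, each represented by (a separate copy of) ℕ.
ConceptName : Set
ConceptName = ℕ

RoleName : Set
RoleName = ℕ

IndName : Set
IndName = ℕ

data Concept : Set where
  atom : ConceptName → Concept
  neg  : Concept → Concept
  conj : Concept → Concept → Concept
  ex   : RoleName → Concept → Concept

data Axiom : Set where
  cassert : Concept → IndName → Axiom
  rassert : RoleName → IndName → IndName → Axiom
  gci     : Concept → Concept → Axiom

-- Interpretations.  Subsets of the domain are predicates Δ → Set.
-- Non-emptiness of Δ is automatic: every individual name is
-- interpreted by an element of Δ (and there are individual names).
record Interp : Set₁ where
  field
    Δ    : Set
    conc : ConceptName → Δ → Set
    role : RoleName → Δ → Δ → Set
    ind  : IndName → Δ

open Interp public

⟦_⟧ : Concept → (I : Interp) → Δ I → Set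
⟦ atom A ⟧ I d = conc I A d
⟦ neg C ⟧ I d = ¬ (⟦ C ⟧ I d)
⟦ conj C D ⟧ I d = ⟦ C ⟧ I d × ⟦ D ⟧ I d
⟦ ex r C ⟧ I d = Σ (Δ I) λ e → role I r d e × ⟦ C ⟧ I e

_⊨_ : Interp → Axiom → Set
I ⊨ cassert C a = ⟦ C ⟧ I (ind I a)
I ⊨ rassert r a b = role I r (ind I a) (ind I b)
I ⊨ gci C D = ∀ d → ⟦ C ⟧ I d → ⟦ D ⟧ I d

Base : Set
Base = List Axiom

ModelSet : Set₁
ModelSet = Interp → Set

Mod : Base → ModelSet
Mod B I = All (I ⊨_) B

_⊆M_ : ModelSet → ModelSet → Set₁
X ⊆M Y = ∀ I → X I → Y I

InFR : ModelSet → Set₁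
InFR Y = Σ Base λ B → (Y ⊆M Mod B) × (Mod B ⊆M Y)

IsFRsub : ModelSet → ModelSet → Set₁
IsFRsub X Y = InFR Y × (Y ⊆M X)
  × (∀ Y' → InFR Y' → Y ⊆M Y' → Y' ⊆M X → Y' ⊆M Y)

IsFRsup : ModelSet → ModelSet → Set₁
IsFRsup X Y = InFR Y × (X ⊆M Y)
  × (∀ Y' → InFR Y' → Y' ⊆M Y → X ⊆M Y' → Y ⊆M Y')

FRsubsNonempty : ModelSet → Set₁
FRsubsNonempty X = Σ ModelSet λ Y → IsFRsub X Y

FRsupsNonempty : ModelSet → Set₁
FRsupsNonempty X = Σ ModelSet λ Y → IsFRsup X Y

EvictionCompatible : Set₁
EvictionCompatible =
  (B : Base) (M : ModelSet) → FRsubsNonempty (λ I → Mod B I × ¬ M I)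

ReceptionCompatible : Set₁
ReceptionCompatible =
  (B : Base) (M : ModelSet) → FRsupsNonempty (λ I → Mod B I ⊎ M I)

-- A finite base B mentions only concept names up to some k, so changing the
-- extensions of the names above k preserves being a model of B. Take the class
-- Saturated of interpretations in which a₀ belongs to every concept name.
-- Reception: a minimal finitely representable superset Mod B of
-- Mod {⊥(a₀)} ∪ Saturated = Saturated lies inside the superset
-- Mod (B ∪ {A_{k+1}(a₀)}); but emptying the names above k in a saturated
-- interpretation gives a model of B violating A_{k+1}(a₀).
-- Eviction: in a maximal finitely representable subset Mod B of the
-- non-saturated interpretations, no model puts a₀ in A₀, …, A_k (filling the
-- names above k would make it saturated). So Mod B ⊆ Mod {¬(A₀ ⊓ … ⊓ A_{k+1})(a₀)},
-- a non-saturated class, and maximality makes them equal; yet the latter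
-- contains an interpretation putting a₀ in exactly A₀, …, A_k.
module Submission where

open import Defs
open import Data.Empty using (⊥-elim)
open import Data.List using ([]; _∷_; [_])
open import Data.List.Relation.Unary.All using ([]; _∷_; head; tail)
open import Data.Nat using (ℕ; zero; suc; _≤_; _⊔_; z≤n; s≤s)
open import Data.Nat.Properties using (≤-refl; m≤n⇒m≤1+n; m≤n⇒m<n∨m≡n; 1+n≰n; m⊔n≤o⇒m≤o; m⊔n≤o⇒n≤o)
open import Data.Product using (_×_; _,_; proj₁; proj₂)
open import Data.Product.Function.NonDependent.Propositional using (_×-⇔_)
import Data.Product.Function.Dependent.Propositional as Σ
open import Data.Sum using (_⊎_; inj₁; inj₂)
open import Data.Unit using (⊤; tt)
open import Function using (_$_; const)
open import Function.Bundles using (_⇔_; mk⇔; Equivalence)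
open import Function.Related.TypeIsomorphisms using (¬-cong-⇔)
open import Function.Construct.Identity using (⇔-id)
open import Relation.Binary.PropositionalEquality using (refl)
open import Relation.Nullary using (¬_)

conceptNameBound : Concept → ℕ
conceptNameBound (atom A)   = A
conceptNameBound (neg C)    = conceptNameBound C
conceptNameBound (conj C D) = conceptNameBound C ⊔ conceptNameBound D
conceptNameBound (ex r C)   = conceptNameBound C

axiomNameBound : Axiom → ℕ
axiomNameBound (cassert C a)   = conceptNameBound C
axiomNameBound (rassert r a b) = 0
axiomNameBound (gci C D)       = conceptNameBound C ⊔ conceptNameBound D

baseNameBound : Base → ℕ
baseNameBound []      = 0
baseNameBound (α ∷ B) = axiomNameBound α ⊔ baseNameBound B

_[conc≔_] : (I : Interp) → (ConceptName → Δ I → Set) → Interp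
I [conc≔ c ] = record { Δ = Δ I ; conc = c ; role = role I ; ind = ind I }

AgreeBelow : ℕ → (I : Interp) → (ConceptName → Δ I → Set) → Set
AgreeBelow k I c = ∀ {A} → A ≤ k → ∀ d → conc I A d ⇔ c A d

module _ {k : ℕ} {I : Interp} {c : ConceptName → Δ I → Set} (agree : AgreeBelow k I c) where

  ⟦⟧-agreeBelow : ∀ C → conceptNameBound C ≤ k → ∀ d → ⟦ C ⟧ I d ⇔ ⟦ C ⟧ (I [conc≔ c ]) d
  ⟦⟧-agreeBelow (atom A)   A≤k   d = agree A≤k d
  ⟦⟧-agreeBelow (neg C)    C≤k   d = ¬-cong-⇔ (⟦⟧-agreeBelow C C≤k d)
  ⟦⟧-agreeBelow (conj C D) CD≤k  d =
    ⟦⟧-agreeBelow C (m⊔n≤o⇒m≤o _ _ CD≤k) d ×-⇔ ⟦⟧-agreeBelow D (m⊔n≤o⇒n≤o _ _ CD≤k) d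
  ⟦⟧-agreeBelow (ex r C)   C≤k   d = Σ.congˡ (⇔-id _ ×-⇔ ⟦⟧-agreeBelow C C≤k _)

  ⊨-agreeBelow : ∀ α → axiomNameBound α ≤ k → I ⊨ α → (I [conc≔ c ]) ⊨ α
  ⊨-agreeBelow (cassert C a)   C≤k  I⊨α = Equivalence.to (⟦⟧-agreeBelow C C≤k (ind I a)) I⊨α
  ⊨-agreeBelow (rassert r a b) _    I⊨α = I⊨α
  ⊨-agreeBelow (gci C D)       CD≤k I⊨α d d∈C =
    Equivalence.to (⟦⟧-agreeBelow D (m⊔n≤o⇒n≤o _ _ CD≤k) d)
      (I⊨α d (Equivalence.from (⟦⟧-agreeBelow C (m⊔n≤o⇒m≤o _ _ CD≤k) d) d∈C))

  Mod-agreeBelow : ∀ B → baseNameBound B ≤ k → Mod B I → Mod B (I [conc≔ c ])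
  Mod-agreeBelow []      _    []         = []
  Mod-agreeBelow (α ∷ B) αB≤k (I⊨α ∷ I⊨B) =
    ⊨-agreeBelow α (m⊔n≤o⇒m≤o _ _ αB≤k) I⊨α ∷ Mod-agreeBelow B (m⊔n≤o⇒n≤o _ _ αB≤k) I⊨B

clearAbove : ℕ → Interp → Interp
clearAbove k I = I [conc≔ (λ A d → A ≤ k × conc I A d) ]

fillAbove : ℕ → Interp → Interp
fillAbove k I = I [conc≔ (λ A d → A ≤ k → conc I A d) ]

clearAbove-agree : ∀ {k I} → AgreeBelow k I (conc (clearAbove k I))
clearAbove-agree A≤k _ = mk⇔ (A≤k ,_) proj₂

fillAbove-agree : ∀ {k I} → AgreeBelow k I (conc (fillAbove k I))
fillAbove-agree A≤k _ = mk⇔ const (_$ A≤k)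

full : Interp
full = record { Δ = ⊤ ; conc = λ _ _ → ⊤ ; role = λ _ _ _ → ⊤ ; ind = λ _ → tt }

Saturated : ModelSet
Saturated I = ∀ A → conc I A (ind I 0)

allAtomsUpTo : ℕ → Concept
allAtomsUpTo zero    = atom 0
allAtomsUpTo (suc n) = conj (atom (suc n)) (allAtomsUpTo n)

allAtomsUpTo-elim : ∀ n {I d} → ⟦ allAtomsUpTo n ⟧ I d → ∀ {A} → A ≤ n → conc I A d
allAtomsUpTo-elim zero    d∈A₀       z≤n = d∈A₀
allAtomsUpTo-elim (suc n) (d∈Aₙ , d∈C) A≤1+n with m≤n⇒m<n∨m≡n A≤1+n
... | inj₁ (s≤s A≤n) = allAtomsUpTo-elim n d∈C A≤n
... | inj₂ refl      = d∈Aₙ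

allAtomsUpTo-intro : ∀ n {I d} → (∀ A → conc I A d) → ⟦ allAtomsUpTo n ⟧ I d
allAtomsUpTo-intro zero    d∈A = d∈A 0
allAtomsUpTo-intro (suc n) d∈A = d∈A (suc n) , allAtomsUpTo-intro n d∈A

Mod-InFR : ∀ B → InFR (Mod B)
Mod-InFR B = B , (λ _ h → h) , (λ _ h → h)

inconsistent : Axiom
inconsistent = cassert (conj (atom 0) (neg (atom 0))) 0

¬receptionCompatible : ¬ ReceptionCompatible
¬receptionCompatible rc with rc [ inconsistent ] Saturated
... | Y , (B , Y⊆B , B⊆Y) , X⊆Y , minimal = 1+n≰n (proj₁ (head (Y⊆Y′ _ (B⊆Y _ cleared))))
  where
  k = baseNameBound B
  Y′ = Mod (cassert (atom (suc k)) 0 ∷ B)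

  X⊆Y′ : (λ I → Mod [ inconsistent ] I ⊎ Saturated I) ⊆M Y′
  X⊆Y′ I (inj₁ ((x , ¬x) ∷ [])) = ⊥-elim (¬x x)
  X⊆Y′ I (inj₂ sat)               = sat (suc k) ∷ Y⊆B I (X⊆Y I (inj₂ sat))

  Y⊆Y′ : Y ⊆M Y′
  Y⊆Y′ = minimal Y′ (Mod-InFR _) (λ I h → B⊆Y I (tail h)) X⊆Y′

  cleared : Mod B (clearAbove k full)
  cleared = Mod-agreeBelow (clearAbove-agree {I = full}) B ≤-refl (Y⊆B full (X⊆Y full (inj₂ (λ _ → tt))))

¬evictionCompatible : ¬ EvictionCompatible
¬evictionCompatible ec with ec [] Saturated
... | Y , (B , Y⊆B , B⊆Y) , Y⊆X , maximal = unsaturated cleared (λ A A≤k → A≤k , tt)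
  where
  k = baseNameBound B

  unsaturated : ∀ {I} → Mod B I → ¬ (∀ A → A ≤ k → conc I A (ind I 0))
  unsaturated {I} I⊨B sat =
    proj₂ (Y⊆X _ (B⊆Y _ (Mod-agreeBelow (fillAbove-agree {I = I}) B ≤-refl I⊨B))) sat

  Y′ = Mod [ cassert (neg (allAtomsUpTo (suc k))) 0 ]

  Y⊆Y′ : Y ⊆M Y′
  Y⊆Y′ I y = (λ a₀∈C → unsaturated (Y⊆B I y)
                 (λ A A≤k → allAtomsUpTo-elim (suc k) a₀∈C (m≤n⇒m≤1+n A≤k))) ∷ []

  Y′⊆X : Y′ ⊆M (λ I → Mod [] I × ¬ Saturated I)
  Y′⊆X I (a₀∉C ∷ []) = [] , λ sat → a₀∉C (allAtomsUpTo-intro (suc k) sat)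

  cleared : Mod B (clearAbove k full)
  cleared = Y⊆B _ (maximal Y′ (Mod-InFR _) Y⊆Y′ Y′⊆X _
              ((λ a₀∈C → 1+n≰n (proj₁ (allAtomsUpTo-elim (suc k) a₀∈C ≤-refl))) ∷ []))

theorem9 : (¬ ReceptionCompatible) × (¬ EvictionCompatible)
theorem9 = ¬receptionCompatible , ¬evictionCompatible
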